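{- Let $T=N^yE^x$ and let $B$ be a lattice path with steps $N=(0,1)$, $E=(1,0)$ from the origin to $(x,y)$, weakly below $T$, whose last step is a north step. Then for all $i,j\ge0$, the number of paths in $\mathcal P(T,B)$ with $i$ top contacts and $j$ bottom contacts equals the number of lattice paths with steps $N,E$ from the origin to $(x-i-j,\,y-2)$ staying weakly above $B$.
   Context: $\mathcal P(T,B)$ is the set of lattice paths with steps $N,E$ from the origin to $(x,y)$ lying weakly above $B$ and weakly below $T$ (weakly above $B$ meaning no point of the path lies strictly below or strictly to the right of $B$). A top (bottom) contact of a path is an east step of it that is also a step of $T$ (of $B$). -}

module Defs where

open import Data.Bool using (Bool; true; false; _∧_; _∨_; not; if_then_else_)
open import Data.Nat using (ℕ; zero; suc; _+_; _∸_; _≡ᵇ_; _<ᵇ_; _≤ᵇ_)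
open import Data.Product using (_×_; _,_)
open import Data.List using (List; []; _∷_; _++_; map; replicate; length; filterᵇ)
open import Data.Bool.ListAction using (any; all)

data Step : Set where
  N E : Step

Path : Set
Path = List Step

Point : Set
Point = ℕ × ℕ

move : Point → Step → Point
move (a , b) N = (a , suc b)
move (a , b) E = (suc a , b)

pointsFrom : Point → Path → List Point
pointsFrom p []       = p ∷ []
pointsFrom p (s ∷ ss) = p ∷ pointsFrom (move p s) ss

points : Path → List Point
points = pointsFrom (0 , 0)

endpointFrom : Point → Path → Point
endpointFrom p []       = p
endpointFrom p (s ∷ ss) = endpointFrom (move p s) ss

endpoint : Path → Point
endpoint = endpointFrom (0 , 0)

Edge : Set
Edge = Point × Step

edgesFrom : Point → Path → List Edge
edgesFrom p []       = []
edgesFrom p (s ∷ ss) = (p , s) ∷ edgesFrom (move p s) ss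

edges : Path → List Edge
edges = edgesFrom (0 , 0)

isE : Step → Bool
isE N = false
isE E = true

_==ₛ_ : Step → Step → Bool
N ==ₛ N = true
E ==ₛ E = true
_ ==ₛ _ = false

_==ₚ_ : Point → Point → Bool
(a , b) ==ₚ (c , d) = (a ≡ᵇ c) ∧ (b ≡ᵇ d)

_==ₑ_ : Edge → Edge → Bool
(p , s) ==ₑ (q , t) = (p ==ₚ q) ∧ (s ==ₛ t)

elemₑ : Edge → List Edge → Bool
elemₑ e es = any (e ==ₑ_) es

strictlyBelow : Path → Point → Bool
strictlyBelow B (a , b) =
  any (λ { (c , d) → c ≡ᵇ a }) (points B) ∧
  all (λ { (c , d) → not (c ≡ᵇ a) ∨ (b <ᵇ d) }) (points B)

strictlyRight : Path → Point → Bool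
strictlyRight B (a , b) =
  any (λ { (c , d) → d ≡ᵇ b }) (points B) ∧
  all (λ { (c , d) → not (d ≡ᵇ b) ∨ (c <ᵇ a) }) (points B)

weaklyAbove : Path → Path → Bool
weaklyAbove P B = all (λ q → not (strictlyBelow B q) ∧ not (strictlyRight B q)) (points P)

weaklyBelow : Path → Path → Bool
weaklyBelow P T = weaklyAbove T P

allWords : ℕ → List Path
allWords zero    = [] ∷ []
allWords (suc n) = map (N ∷_) (allWords n) ++ map (E ∷_) (allWords n)

pathsTo : ℕ → ℕ → List Path
pathsTo x y = filterᵇ (λ P → endpoint P ==ₚ (x , y)) (allWords (x + y))

contacts : Path → Path → ℕ
contacts P Q = length (filterᵇ (λ { (p , s) → isE s ∧ elemₑ (p , s) (edges Q) }) (edges P))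

topContacts : Path → Path → ℕ
topContacts T P = contacts P T

bottomContacts : Path → Path → ℕ
bottomContacts B P = contacts P B

𝒫 : ℕ → ℕ → Path → Path → List Path
𝒫 x y T B = filterᵇ (λ P → weaklyAbove P B ∧ weaklyBelow P T) (pathsTo x y)

countContacts : ℕ → ℕ → Path → Path → ℕ → ℕ → ℕ
countContacts x y T B i j =
  length (filterᵇ (λ P → (topContacts T P ≡ᵇ i) ∧ (bottomContacts B P ≡ᵇ j)) (𝒫 x y T B))

countAbove : ℕ → ℕ → Path → ℕ
countAbove a b B = length (filterᵇ (λ Q → weaklyAbove Q B) (pathsTo a b))

-- same, but for the integer target (x - k, b); zero paths if x - k < 0
countAboveShift : ℕ → ℕ → ℕ → Path → ℕ
countAboveShift x k b B = if k ≤ᵇ x then countAbove (x ∸ k) b B else 0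

topPath : ℕ → ℕ → Path
topPath x y = replicate y N ++ replicate x E

lastStep : Path → Step → Bool
lastStep []           s = false
lastStep (t ∷ [])     s = t ==ₛ s
lastStep (_ ∷ t ∷ ts) s = lastStep (t ∷ ts) s

-- Let ℓ(a) be the height at which B enters column a. A point (a , b) with
-- a ≤ x is weakly above B iff ℓ(a) ≤ b, and an east step out of (a , b) is a
-- bottom contact iff ℓ(a + 1) = b; ℓ is weakly increasing, and ℓ(x) < y since B
-- ends with a north step. Splitting paths by their last step, the number of
-- paths to (m , n), n < y, with j bottom contacts satisfies the same recursion
-- as the number of paths weakly above B to (m − j , n − 1): an east step onto
-- ℓ(m) uses up one contact, and otherwise the point below is allowed. A path
-- to (x , y) with i top contacts ends with i east steps in row y, so it is
-- counted by the paths to (x − i − j , y − 2).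

module Submission where

open import Defs
open import Data.Bool using (Bool; true; false; T; _∧_; _∨_; not; if_then_else_)
open import Data.Bool.Properties using (∧-zeroʳ; ∧-identityʳ; ∨-identityʳ; ∧-assoc)
open import Data.Bool.Solver using (module ∨-∧-Solver)
open import Data.Bool.ListAction using (any; all)
open import Data.Empty using (⊥-elim)
open import Data.List using (List; []; _∷_; _++_; [_]; map; replicate; length; filterᵇ; _∷ʳ_)
open import Data.List.Properties using (length-++; filter-++)
open import Data.Nat using (ℕ; zero; suc; _+_; _∸_; _≤_; _<_; z≤n; s≤s; _≡ᵇ_; _<ᵇ_; _≤ᵇ_)
open import Data.Nat.Properties
open import Algebra.Properties.CommutativeSemigroup +-commutativeSemigroup using (interchange)
open import Data.Product using (_,_; proj₁; proj₂)
open import Data.Sum using (inj₁; inj₂)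
open import Data.Unit using (tt)
open import Function using (_∘_)
open import Relation.Binary.PropositionalEquality using (_≡_; refl; sym; trans; cong; cong₂; subst; module ≡-Reasoning)
open import Relation.Nullary using (¬_; yes; no)
open import Relation.Nullary.Decidable using (T?)

T⇒≡true : ∀ {b} → T b → b ≡ true
T⇒≡true {true} _ = refl

≡true⇒T : ∀ {b} → b ≡ true → T b
≡true⇒T refl = tt

¬T⇒≡false : ∀ {b} → ¬ T b → b ≡ false
¬T⇒≡false {false} _  = refl
¬T⇒≡false {true}  ¬t = ⊥-elim (¬t tt)

≡ᵇ-refl : ∀ n → (n ≡ᵇ n) ≡ true
≡ᵇ-refl n = T⇒≡true (≡⇒≡ᵇ n n refl)

≢⇒≡ᵇ-false : ∀ {m n} → ¬ m ≡ n → (m ≡ᵇ n) ≡ false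
≢⇒≡ᵇ-false {m} {n} m≢n = ¬T⇒≡false (m≢n ∘ ≡ᵇ⇒≡ m n)

≡ᵇ-true⇒≡ : ∀ {m n} → (m ≡ᵇ n) ≡ true → m ≡ n
≡ᵇ-true⇒≡ {m} {n} = ≡ᵇ⇒≡ m n ∘ ≡true⇒T

<⇒<ᵇ-true : ∀ {m n} → m < n → (m <ᵇ n) ≡ true
<⇒<ᵇ-true = T⇒≡true ∘ <⇒<ᵇ

≥⇒<ᵇ-false : ∀ {m n} → n ≤ m → (m <ᵇ n) ≡ false
≥⇒<ᵇ-false {m} {n} n≤m = ¬T⇒≡false (≤⇒≯ n≤m ∘ <ᵇ⇒< m n)

≤⇒≤ᵇ-true : ∀ {m n} → m ≤ n → (m ≤ᵇ n) ≡ true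
≤⇒≤ᵇ-true = T⇒≡true ∘ ≤⇒≤ᵇ

>⇒≤ᵇ-false : ∀ {m n} → n < m → (m ≤ᵇ n) ≡ false
>⇒≤ᵇ-false {m} {n} n<m = ¬T⇒≡false (<⇒≱ n<m ∘ ≤ᵇ⇒≤ m n)

≤ᵇ-true⇒≤ : ∀ {m n} → (m ≤ᵇ n) ≡ true → m ≤ n
≤ᵇ-true⇒≤ {m} {n} = ≤ᵇ⇒≤ m n ∘ ≡true⇒T

≡ᵇ-sym : ∀ m n → (m ≡ᵇ n) ≡ (n ≡ᵇ m)
≡ᵇ-sym m n with m ≟ n
... | yes refl = refl
... | no m≢n rewrite ≢⇒≡ᵇ-false m≢n | ≢⇒≡ᵇ-false (m≢n ∘ sym) = refl

<ᵇ-∧-<ᵇ-suc : ∀ b d → (b <ᵇ d) ∧ (b <ᵇ suc d) ≡ (b <ᵇ d)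
<ᵇ-∧-<ᵇ-suc b d with b <ᵇ d in b<d
... | false = refl
... | true  = <⇒<ᵇ-true (m<n⇒m<1+n (<ᵇ⇒< b d (≡true⇒T b<d)))

≤ᵇ-pred : ∀ l b → l ≤ suc b → (l ≤ᵇ b) ≡ not (l ≡ᵇ suc b)
≤ᵇ-pred l b l≤1+b with l ≟ suc b
... | yes refl rewrite ≡ᵇ-refl b = >⇒≤ᵇ-false (≤-refl {suc b})
... | no l≢1+b rewrite ≢⇒≡ᵇ-false l≢1+b = ≤⇒≤ᵇ-true (≤-pred (≤∧≢⇒< l≤1+b l≢1+b))

+1≡ᵇ-suc : ∀ b j → (b + 1 ≡ᵇ suc j) ≡ (b ≡ᵇ j)
+1≡ᵇ-suc b j rewrite +-comm b 1 = refl

+1≡ᵇ-zero : ∀ b → (b + 1 ≡ᵇ 0) ≡ false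
+1≡ᵇ-zero b rewrite +-comm b 1 = refl

≤ᵇ-suc : ∀ a b → (suc a ≤ᵇ suc b) ≡ (a ≤ᵇ b)
≤ᵇ-suc zero    b = refl
≤ᵇ-suc (suc a) b = refl

==ₚ-true⇒≡ : ∀ p q → (p ==ₚ q) ≡ true → p ≡ q
==ₚ-true⇒≡ (a , b) (c , d) e with a ≡ᵇ c in a≡c | b ≡ᵇ d in b≡d
... | true | true = cong₂ _,_ (≡ᵇ-true⇒≡ a≡c) (≡ᵇ-true⇒≡ b≡d)

==ₚ-subst : ∀ p q (f : Point → Bool) → (p ==ₚ q) ∧ f p ≡ (p ==ₚ q) ∧ f q
==ₚ-subst p q f with p ==ₚ q in p≡q
... | false = refl
... | true  = cong f (==ₚ-true⇒≡ p q p≡q)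

∧-rearrange : ∀ a b c d → a ∧ ((b ∧ c) ∧ d) ≡ c ∧ (a ∧ (b ∧ d))
∧-rearrange = solve 4 (λ a b c d → a :* ((b :* c) :* d) := c :* (a :* (b :* d))) refl
  where open ∨-∧-Solver

if-true : ∀ {A : Set} {c} {a b : A} → c ≡ true → (if c then a else b) ≡ a
if-true refl = refl

if-false : ∀ {A : Set} {c} {a b : A} → c ≡ false → (if c then a else b) ≡ b
if-false refl = refl

if-+ : ∀ (c : Bool) a b → (if c then a else 0) + (if c then b else 0) ≡ (if c then a + b else 0)
if-+ true  a b = refl
if-+ false a b = refl

if-0 : ∀ (c : Bool) → (if c then 0 else 0) ≡ 0
if-0 true  = refl
if-0 false = refl

indicator : Bool → ℕ
indicator b = if b then 1 else 0

countᵇ : {A : Set} → (A → Bool) → List A → ℕ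
countᵇ p xs = length (filterᵇ p xs)

countᵇ-map : ∀ {A B : Set} (p : B → Bool) (f : A → B) xs → countᵇ p (map f xs) ≡ countᵇ (p ∘ f) xs
countᵇ-map p f []       = refl
countᵇ-map p f (x ∷ xs) with p (f x)
... | true  = cong suc (countᵇ-map p f xs)
... | false = countᵇ-map p f xs

module _ {A : Set} where

  countᵇ-++ : ∀ (p : A → Bool) xs ys → countᵇ p (xs ++ ys) ≡ countᵇ p xs + countᵇ p ys
  countᵇ-++ p xs ys = trans (cong length (filter-++ (T? ∘ p) xs ys)) (length-++ (filterᵇ p xs))

  countᵇ-∷ʳ : ∀ (p : A → Bool) xs x → countᵇ p (xs ∷ʳ x) ≡ countᵇ p xs + indicator (p x)
  countᵇ-∷ʳ p xs x with p x | countᵇ-++ p xs [ x ]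
  ... | true  | eq = eq
  ... | false | eq = eq

  countᵇ-cong : ∀ {p q : A → Bool} → (∀ x → p x ≡ q x) → ∀ xs → countᵇ p xs ≡ countᵇ q xs
  countᵇ-cong p≗q []       = refl
  countᵇ-cong {p} {q} p≗q (x ∷ xs) with p x | q x | p≗q x
  ... | true  | true  | refl = cong suc (countᵇ-cong p≗q xs)
  ... | false | false | refl = countᵇ-cong p≗q xs

  countᵇ-none : ∀ {p : A → Bool} → (∀ x → p x ≡ false) → ∀ xs → countᵇ p xs ≡ 0
  countᵇ-none p≗false []       = refl
  countᵇ-none {p} p≗false (x ∷ xs) with p x | p≗false x
  ... | false | refl = countᵇ-none p≗false xs

  countᵇ-filterᵇ : ∀ (p q : A → Bool) xs → countᵇ p (filterᵇ q xs) ≡ countᵇ (λ x → q x ∧ p x) xs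
  countᵇ-filterᵇ p q []       = refl
  countᵇ-filterᵇ p q (x ∷ xs) with q x
  ... | false = countᵇ-filterᵇ p q xs
  ... | true with p x
  ...   | true  = cong suc (countᵇ-filterᵇ p q xs)
  ...   | false = countᵇ-filterᵇ p q xs

  all-∷ʳ : ∀ (p : A → Bool) xs x → all p (xs ∷ʳ x) ≡ all p xs ∧ p x
  all-∷ʳ p []       x = ∧-identityʳ (p x)
  all-∷ʳ p (y ∷ xs) x = trans (cong (p y ∧_) (all-∷ʳ p xs x)) (sym (∧-assoc (p y) _ (p x)))

countWords : (Path → Bool) → ℕ → ℕ
countWords p k = countᵇ p (allWords k)

countWords-∷ : ∀ p k → countWords p (suc k) ≡ countWords (p ∘ (N ∷_)) k + countWords (p ∘ (E ∷_)) k
countWords-∷ p k = trans (countᵇ-++ p (map (N ∷_) (allWords k)) _)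
  (cong₂ _+_ (countᵇ-map p (N ∷_) (allWords k)) (countᵇ-map p (E ∷_) (allWords k)))

countWords-zero : ∀ p → countWords p 0 ≡ indicator (p [])
countWords-zero p with p []
... | true  = refl
... | false = refl

countWords-∷ʳ : ∀ p k → countWords p (suc k) ≡ countWords (p ∘ (_∷ʳ N)) k + countWords (p ∘ (_∷ʳ E)) k
countWords-∷ʳ p zero = trans (countWords-∷ p zero)
  (trans (cong₂ _+_ (countWords-zero (p ∘ (N ∷_))) (countWords-zero (p ∘ (E ∷_))))
         (sym (cong₂ _+_ (countWords-zero (p ∘ (_∷ʳ N))) (countWords-zero (p ∘ (_∷ʳ E))))))
countWords-∷ʳ p (suc k) = begin
  countWords p (suc (suc k))
    ≡⟨ countWords-∷ p (suc k) ⟩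
  countWords (p ∘ (N ∷_)) (suc k) + countWords (p ∘ (E ∷_)) (suc k)
    ≡⟨ cong₂ _+_ (countWords-∷ʳ (p ∘ (N ∷_)) k) (countWords-∷ʳ (p ∘ (E ∷_)) k) ⟩
  (countWords (λ w → p (N ∷ w ∷ʳ N)) k + countWords (λ w → p (N ∷ w ∷ʳ E)) k) +
  (countWords (λ w → p (E ∷ w ∷ʳ N)) k + countWords (λ w → p (E ∷ w ∷ʳ E)) k)
    ≡⟨ interchange (countWords (λ w → p (N ∷ w ∷ʳ N)) k) (countWords (λ w → p (N ∷ w ∷ʳ E)) k) _ _ ⟩
  (countWords (λ w → p (N ∷ w ∷ʳ N)) k + countWords (λ w → p (E ∷ w ∷ʳ N)) k) +
  (countWords (λ w → p (N ∷ w ∷ʳ E)) k + countWords (λ w → p (E ∷ w ∷ʳ E)) k)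
    ≡⟨ sym (cong₂ _+_ (countWords-∷ (p ∘ (_∷ʳ N)) k) (countWords-∷ (p ∘ (_∷ʳ E)) k)) ⟩
  countWords (p ∘ (_∷ʳ N)) (suc k) + countWords (p ∘ (_∷ʳ E)) (suc k) ∎
  where open ≡-Reasoning

countWords-if : ∀ c q k → countWords (λ w → c ∧ q w) k ≡ (if c then countWords q k else 0)
countWords-if true  q k = refl
countWords-if false q k = countᵇ-none (λ _ → refl) (allWords k)

pointsFrom-∷ʳ : ∀ p w s → pointsFrom p (w ∷ʳ s) ≡ pointsFrom p w ∷ʳ move (endpointFrom p w) s
pointsFrom-∷ʳ p []      s = refl
pointsFrom-∷ʳ p (t ∷ w) s = cong (p ∷_) (pointsFrom-∷ʳ (move p t) w s)

edgesFrom-∷ʳ : ∀ p w s → edgesFrom p (w ∷ʳ s) ≡ edgesFrom p w ∷ʳ (endpointFrom p w , s)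
edgesFrom-∷ʳ p []      s = refl
edgesFrom-∷ʳ p (t ∷ w) s = cong ((p , t) ∷_) (edgesFrom-∷ʳ (move p t) w s)

endpointFrom-∷ʳ : ∀ p w s → endpointFrom p (w ∷ʳ s) ≡ move (endpointFrom p w) s
endpointFrom-∷ʳ p []      s = refl
endpointFrom-∷ʳ p (t ∷ w) s = endpointFrom-∷ʳ (move p t) w s

column-≤-move : ∀ p s → proj₁ p ≤ proj₁ (move p s)
column-≤-move p N = ≤-refl
column-≤-move p E = n≤1+n (proj₁ p)

row-≤-move : ∀ p s → proj₂ p ≤ proj₂ (move p s)
row-≤-move p N = n≤1+n (proj₂ p)
row-≤-move p E = ≤-refl

column-≤-move-≢ : ∀ p s {a} → proj₁ p ≤ a → ¬ a ≡ proj₁ p → proj₁ (move p s) ≤ a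
column-≤-move-≢ p N c≤a _   = c≤a
column-≤-move-≢ p E c≤a a≢c = ≤∧≢⇒< c≤a (a≢c ∘ sym)

row-≤-move-≢ : ∀ p s {b} → proj₂ p ≤ b → ¬ proj₂ p ≡ b → proj₂ (move p s) ≤ b
row-≤-move-≢ p N d≤b d≢b = ≤∧≢⇒< d≤b d≢b
row-≤-move-≢ p E d≤b _   = d≤b

column-≤-end : ∀ p P → proj₁ p ≤ proj₁ (endpointFrom p P)
column-≤-end p []      = ≤-refl
column-≤-end p (s ∷ P) = ≤-trans (column-≤-move p s) (column-≤-end (move p s) P)

row-≤-end : ∀ p P → proj₂ p ≤ proj₂ (endpointFrom p P)
row-≤-end p []      = ≤-refl
row-≤-end p (s ∷ P) = ≤-trans (row-≤-move p s) (row-≤-end (move p s) P)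

-- The lowest point of a path in a column

-- The height at which the path from p first reaches column a (junk for a
-- column it never visits).
lowestFrom : Point → Path → ℕ → ℕ
lowestFrom p []      a = proj₂ p
lowestFrom p (s ∷ P) a = if a ≡ᵇ proj₁ p then proj₂ p else lowestFrom (move p s) P a

lowest : Path → ℕ → ℕ
lowest = lowestFrom (0 , 0)

lowestFrom-start : ∀ p P → lowestFrom p P (proj₁ p) ≡ proj₂ p
lowestFrom-start p []      = refl
lowestFrom-start p (s ∷ P) rewrite ≡ᵇ-refl (proj₁ p) = refl

row-≤-lowestFrom : ∀ p P a → proj₂ p ≤ lowestFrom p P a
row-≤-lowestFrom p []      a = ≤-refl
row-≤-lowestFrom p (s ∷ P) a with a ≡ᵇ proj₁ p
... | true  = ≤-refl
... | false = ≤-trans (row-≤-move p s) (row-≤-lowestFrom (move p s) P a)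

lowestFrom-≤-end : ∀ p P a → lowestFrom p P a ≤ proj₂ (endpointFrom p P)
lowestFrom-≤-end p []      a = ≤-refl
lowestFrom-≤-end p (s ∷ P) a with a ≡ᵇ proj₁ p
... | true  = row-≤-end p (s ∷ P)
... | false = lowestFrom-≤-end (move p s) P a

lowestFrom-mono : ∀ p P a → proj₁ p ≤ a → lowestFrom p P a ≤ lowestFrom p P (suc a)
lowestFrom-mono p []      a c≤a = ≤-refl
lowestFrom-mono p (s ∷ P) a c≤a
  rewrite ≢⇒≡ᵇ-false {suc a} {proj₁ p} (λ e → <-irrefl (sym e) (s≤s c≤a)) with a ≟ proj₁ p
... | yes refl rewrite ≡ᵇ-refl a = ≤-trans (row-≤-move p s) (row-≤-lowestFrom (move p s) P (suc a))
... | no a≢c rewrite ≢⇒≡ᵇ-false a≢c =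
  lowestFrom-mono (move p s) P a (column-≤-move-≢ p s c≤a a≢c)

lowest-mono : ∀ P {a a′} → a ≤ a′ → lowest P a ≤ lowest P a′
lowest-mono P {a} {zero}   z≤n = ≤-refl
lowest-mono P {a} {suc a′} a≤ with m≤n⇒m<n∨m≡n a≤
... | inj₁ a<    = ≤-trans (lowest-mono P (≤-pred a<)) (lowestFrom-mono (0 , 0) P a′ z≤n)
... | inj₂ refl = ≤-refl

lowestFrom-∷-end : ∀ p s P →
  lowestFrom (move p s) P (proj₁ (endpointFrom (move p s) P)) < proj₂ (endpointFrom (move p s) P) →
  lowestFrom p (s ∷ P) (proj₁ (endpointFrom (move p s) P)) < proj₂ (endpointFrom (move p s) P)
lowestFrom-∷-end p s P below with proj₁ (endpointFrom (move p s) P) ≡ᵇ proj₁ p in end≡c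
... | false = below
... | true with s
...   | N = row-≤-end (move p N) P
...   | E = ⊥-elim (<-irrefl (sym (≡ᵇ-true⇒≡ end≡c)) (column-≤-end (move p E) P))

lowestFrom-lastStep : ∀ p P → lastStep P N ≡ true →
  lowestFrom p P (proj₁ (endpointFrom p P)) < proj₂ (endpointFrom p P)
lowestFrom-lastStep p (N ∷ [])        _    rewrite ≡ᵇ-refl (proj₁ p) = ≤-refl
lowestFrom-lastStep p (s ∷ P@(_ ∷ _)) last = lowestFrom-∷-end p s P (lowestFrom-lastStep (move p s) P last)

-- Weakly above a path, read off from its lowest points

-- strictlyBelow B and strictlyRight B unfold to these on points B.
strictlyBelowₗ strictlyRightₗ : List Point → Point → Bool
strictlyBelowₗ qs (a , b) =
  any (λ q → proj₁ q ≡ᵇ a) qs ∧ all (λ q → not (proj₁ q ≡ᵇ a) ∨ (b <ᵇ proj₂ q)) qs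
strictlyRightₗ qs (a , b) =
  any (λ q → proj₂ q ≡ᵇ b) qs ∧ all (λ q → not (proj₂ q ≡ᵇ b) ∨ (proj₁ q <ᵇ a)) qs

allowedBy : Path → Point → Bool
allowedBy B q = not (strictlyBelow B q) ∧ not (strictlyRight B q)

meetsColumn : ∀ p P a → proj₁ p ≤ a → a ≤ proj₁ (endpointFrom p P) →
  any (λ q → proj₁ q ≡ᵇ a) (pointsFrom p P) ≡ true
meetsColumn p []      a c≤a a≤end rewrite ≤-antisym c≤a a≤end | ≡ᵇ-refl a = refl
meetsColumn p (s ∷ P) a c≤a a≤end with a ≟ proj₁ p
... | yes refl rewrite ≡ᵇ-refl a = refl
... | no a≢c rewrite ≢⇒≡ᵇ-false (a≢c ∘ sym) =
  meetsColumn (move p s) P a (column-≤-move-≢ p s c≤a a≢c) a≤end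

leavesColumn : ∀ p P a (f : Point → Bool) → a < proj₁ p →
  all (λ q → not (proj₁ q ≡ᵇ a) ∨ f q) (pointsFrom p P) ≡ true
leavesColumn p []      a f a<c rewrite ≢⇒≡ᵇ-false (>⇒≢ a<c) = refl
leavesColumn p (s ∷ P) a f a<c rewrite ≢⇒≡ᵇ-false (>⇒≢ a<c) =
  leavesColumn (move p s) P a f (<-≤-trans a<c (column-≤-move p s))

aboveInColumn : ∀ p P a b → proj₁ p ≤ a → a ≤ proj₁ (endpointFrom p P) →
  all (λ q → not (proj₁ q ≡ᵇ a) ∨ (b <ᵇ proj₂ q)) (pointsFrom p P) ≡ (b <ᵇ lowestFrom p P a)
aboveInColumn p []      a b c≤a a≤end
  rewrite ≤-antisym c≤a a≤end | ≡ᵇ-refl a = ∧-identityʳ _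
aboveInColumn p (s ∷ P) a b c≤a a≤end with a ≟ proj₁ p
... | no a≢c rewrite ≢⇒≡ᵇ-false a≢c | ≢⇒≡ᵇ-false (a≢c ∘ sym) =
  aboveInColumn (move p s) P a b (column-≤-move-≢ p s c≤a a≢c) a≤end
... | yes refl with s
...   | N rewrite ≡ᵇ-refl a | aboveInColumn (move p N) P a b ≤-refl a≤end
              | lowestFrom-start (move p N) P = <ᵇ-∧-<ᵇ-suc b (proj₂ p)
...   | E rewrite ≡ᵇ-refl a | leavesColumn (move p E) P a (λ q → b <ᵇ proj₂ q) ≤-refl = ∧-identityʳ _

meetsStartRow : ∀ p P → any (λ q → proj₂ q ≡ᵇ proj₂ p) (pointsFrom p P) ≡ true
meetsStartRow p []      rewrite ≡ᵇ-refl (proj₂ p) = refl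
meetsStartRow p (s ∷ P) rewrite ≡ᵇ-refl (proj₂ p) = refl

notRightBeforeColumn : ∀ p P a b → a < proj₁ p → strictlyRightₗ (pointsFrom p P) (a , b) ≡ false
notRightBeforeColumn p []      a b a<c rewrite ≥⇒<ᵇ-false (<⇒≤ a<c) with proj₂ p ≡ᵇ b
... | true  = refl
... | false = refl
notRightBeforeColumn p (s ∷ P) a b a<c rewrite ≥⇒<ᵇ-false (<⇒≤ a<c) with proj₂ p ≡ᵇ b
... | true  = refl
... | false = notRightBeforeColumn (move p s) P a b (<-≤-trans a<c (column-≤-move p s))

-- Climbing column a up to height b, the path has a point in row b at a column ≥ a.
notRightOfLowest : ∀ p P a b → proj₁ p ≤ a → a ≤ proj₁ (endpointFrom p P) → proj₂ p ≤ b →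
  lowestFrom p P a ≤ b → strictlyRightₗ (pointsFrom p P) (a , b) ≡ false
notRightOfLowest p []      a b c≤a a≤end d≤b low≤b
  rewrite ≤-antisym c≤a a≤end | ≥⇒<ᵇ-false (≤-refl {a}) with proj₂ p ≡ᵇ b
... | true  = refl
... | false = refl
notRightOfLowest p (s ∷ P) a b c≤a a≤end d≤b low≤b with proj₂ p ≟ b | a ≟ proj₁ p | s
... | yes refl | yes refl | _ rewrite ≡ᵇ-refl (proj₂ p) | ≥⇒<ᵇ-false (≤-refl {a}) = refl
... | yes refl | no a≢c | N rewrite ≢⇒≡ᵇ-false a≢c =
  ⊥-elim (<⇒≱ (row-≤-lowestFrom (move p N) P a) low≤b)
... | yes refl | no a≢c | E rewrite ≢⇒≡ᵇ-false a≢c | ≡ᵇ-refl (proj₂ p)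
                                  | <⇒<ᵇ-true (≤∧≢⇒< c≤a (a≢c ∘ sym)) =
  trans (cong (_∧ all (λ q → not (proj₂ q ≡ᵇ proj₂ p) ∨ (proj₁ q <ᵇ a)) (pointsFrom (move p E) P))
               (sym (meetsStartRow (move p E) P)))
        (notRightOfLowest (move p E) P a b (≤∧≢⇒< c≤a (a≢c ∘ sym)) a≤end ≤-refl low≤b)
... | no d≢b | yes refl | N rewrite ≢⇒≡ᵇ-false d≢b =
  notRightOfLowest (move p N) P a b ≤-refl a≤end (≤∧≢⇒< d≤b d≢b)
    (≤-trans (≤-reflexive (lowestFrom-start (move p N) P)) (≤∧≢⇒< d≤b d≢b))
... | no d≢b | yes refl | E rewrite ≢⇒≡ᵇ-false d≢b = notRightBeforeColumn (move p E) P a b ≤-refl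
... | no d≢b | no a≢c | t rewrite ≢⇒≡ᵇ-false d≢b | ≢⇒≡ᵇ-false a≢c =
  notRightOfLowest (move p t) P a b (column-≤-move-≢ p t c≤a a≢c) a≤end (row-≤-move-≢ p t d≤b d≢b) low≤b

strictlyBelow-lowest : ∀ B a b → a ≤ proj₁ (endpoint B) → strictlyBelow B (a , b) ≡ (b <ᵇ lowest B a)
strictlyBelow-lowest B a b a≤end =
  cong₂ _∧_ (meetsColumn (0 , 0) B a z≤n a≤end) (aboveInColumn (0 , 0) B a b z≤n a≤end)

allowedBy-lowest : ∀ B a b → a ≤ proj₁ (endpoint B) → allowedBy B (a , b) ≡ (lowest B a ≤ᵇ b)
allowedBy-lowest B a b a≤end with lowest B a ≤? b
... | yes low≤b = begin
  not (strictlyBelow B (a , b)) ∧ not (strictlyRight B (a , b))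
    ≡⟨ cong₂ (λ u v → not u ∧ not v) (strictlyBelow-lowest B a b a≤end)
             (notRightOfLowest (0 , 0) B a b z≤n a≤end z≤n low≤b) ⟩
  not (b <ᵇ lowest B a) ∧ true
    ≡⟨ cong (λ u → not u ∧ true) (≥⇒<ᵇ-false low≤b) ⟩
  true
    ≡⟨ sym (≤⇒≤ᵇ-true low≤b) ⟩
  lowest B a ≤ᵇ b ∎
  where open ≡-Reasoning
... | no low≰b = begin
  not (strictlyBelow B (a , b)) ∧ not (strictlyRight B (a , b))
    ≡⟨ cong (λ u → not u ∧ not (strictlyRight B (a , b))) (strictlyBelow-lowest B a b a≤end) ⟩
  not (b <ᵇ lowest B a) ∧ not (strictlyRight B (a , b))
    ≡⟨ cong (λ u → not u ∧ not (strictlyRight B (a , b))) (<⇒<ᵇ-true (≰⇒> low≰b)) ⟩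
  false
    ≡⟨ sym (>⇒≤ᵇ-false (≰⇒> low≰b)) ⟩
  lowest B a ≤ᵇ b ∎
  where open ≡-Reasoning

noEdgeFromColumn : ∀ p P a b s → a < proj₁ p → elemₑ ((a , b) , s) (edgesFrom p P) ≡ false
noEdgeFromColumn p []      a b s a<c = refl
noEdgeFromColumn p (t ∷ P) a b s a<c rewrite ≢⇒≡ᵇ-false (<⇒≢ a<c) =
  noEdgeFromColumn (move p t) P a b s (<-≤-trans a<c (column-≤-move p t))

-- A monotone path enters column a + 1 through its east step out of column a.
eastEdge-lowestFrom : ∀ p P a b → proj₁ p ≤ a → a < proj₁ (endpointFrom p P) →
  elemₑ ((a , b) , E) (edgesFrom p P) ≡ (lowestFrom p P (suc a) ≡ᵇ b)
eastEdge-lowestFrom p [] a b c≤a a<end = ⊥-elim (<⇒≱ a<end c≤a)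
eastEdge-lowestFrom p (s ∷ P) a b c≤a a<end
  rewrite ≢⇒≡ᵇ-false {suc a} {proj₁ p} (>⇒≢ (s≤s c≤a)) with a ≟ proj₁ p | s
... | yes refl | N rewrite ≡ᵇ-refl a | ∧-zeroʳ (b ≡ᵇ proj₂ p) =
  eastEdge-lowestFrom (move p N) P a b ≤-refl a<end
... | yes refl | E rewrite ≡ᵇ-refl a | noEdgeFromColumn (move p E) P a b E ≤-refl
                         | lowestFrom-start (move p E) P =
  trans (∨-identityʳ _) (trans (∧-identityʳ _) (≡ᵇ-sym b (proj₂ p)))
... | no a≢c | t rewrite ≢⇒≡ᵇ-false a≢c =
  eastEdge-lowestFrom (move p t) P a b (column-≤-move-≢ p t c≤a a≢c) a<end

endpointFrom-northRun : ∀ c d k P → endpointFrom (c , d) (replicate k N ++ P) ≡ endpointFrom (c , k + d) P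
endpointFrom-northRun c d zero    P = refl
endpointFrom-northRun c d (suc k) P =
  trans (endpointFrom-northRun c (suc d) k P) (cong (λ r → endpointFrom (c , r) P) (+-suc k d))

endpointFrom-eastRun : ∀ c d k → endpointFrom (c , d) (replicate k E) ≡ (k + c , d)
endpointFrom-eastRun c d zero    = refl
endpointFrom-eastRun c d (suc k) = trans (endpointFrom-eastRun (suc c) d k) (cong (_, d) (+-suc k c))

endpoint-topPath : ∀ x y → endpoint (topPath x y) ≡ (x , y)
endpoint-topPath x y = begin
  endpointFrom (0 , 0) (replicate y N ++ replicate x E) ≡⟨ endpointFrom-northRun 0 0 y (replicate x E) ⟩
  endpointFrom (0 , y + 0) (replicate x E)             ≡⟨ endpointFrom-eastRun 0 (y + 0) x ⟩
  (x + 0 , y + 0)                                      ≡⟨ cong₂ _,_ (+-identityʳ x) (+-identityʳ y) ⟩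
  (x , y) ∎
  where open ≡-Reasoning

lowestFrom-northRun : ∀ d k P a → lowestFrom (0 , d) (replicate k N ++ P) (suc a) ≡ lowestFrom (0 , k + d) P (suc a)
lowestFrom-northRun d zero    P a = refl
lowestFrom-northRun d (suc k) P a =
  trans (lowestFrom-northRun (suc d) k P a) (cong (λ r → lowestFrom (0 , r) P (suc a)) (+-suc k d))

lowestFrom-eastRun : ∀ c d k a → lowestFrom (c , d) (replicate k E) a ≡ d
lowestFrom-eastRun c d zero    a = refl
lowestFrom-eastRun c d (suc k) a with a ≡ᵇ c
... | true  = refl
... | false = lowestFrom-eastRun (suc c) d k a

eastEdge-topPath : ∀ x y a b → a < x → elemₑ ((a , b) , E) (edges (topPath x y)) ≡ (y ≡ᵇ b)
eastEdge-topPath x y a b a<x = begin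
  elemₑ ((a , b) , E) (edges (topPath x y))
    ≡⟨ eastEdge-lowestFrom (0 , 0) (topPath x y) a b z≤n (subst (a <_) (sym (cong proj₁ (endpoint-topPath x y))) a<x) ⟩
  lowestFrom (0 , 0) (replicate y N ++ replicate x E) (suc a) ≡ᵇ b
    ≡⟨ cong (_≡ᵇ b) (lowestFrom-northRun 0 y (replicate x E) a) ⟩
  lowestFrom (0 , y + 0) (replicate x E) (suc a) ≡ᵇ b
    ≡⟨ cong (_≡ᵇ b) (trans (lowestFrom-eastRun 0 (y + 0) x (suc a)) (+-identityʳ y)) ⟩
  y ≡ᵇ b ∎
  where open ≡-Reasoning

all-northRun : ∀ (f : Point → Bool) d k P → (∀ b → f (0 , b) ≡ true) →
  all f (pointsFrom (0 , d) (replicate k N ++ P)) ≡ all f (pointsFrom (0 , k + d) P)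
all-northRun f d zero    P column0 = refl
all-northRun f d (suc k) P column0 rewrite column0 d =
  trans (all-northRun f (suc d) k P column0) (cong (λ r → all f (pointsFrom (0 , r) P)) (+-suc k d))

all-eastRun : ∀ (f : Point → Bool) c d k → (∀ a → c ≤ a → a ≤ k + c → f (a , d) ≡ true) →
  all f (pointsFrom (c , d) (replicate k E)) ≡ true
all-eastRun f c d zero    row rewrite row c ≤-refl ≤-refl = refl
all-eastRun f c d (suc k) row rewrite row c ≤-refl (m≤n+m c (suc k)) =
  all-eastRun f (suc c) d k (λ a c<a a≤ → row a (<⇒≤ c<a) (≤-trans a≤ (≤-reflexive (+-suc k c))))

weaklyBelow-topPath : ∀ x y w → endpoint w ≡ (x , y) → weaklyBelow w (topPath x y) ≡ true
weaklyBelow-topPath x y w w-end =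
  trans (all-northRun (allowedBy w) 0 y (replicate x E) column0)
        (all-eastRun (allowedBy w) 0 (y + 0) x row)
  where
  column0 : ∀ b → allowedBy w (0 , b) ≡ true
  column0 b = trans (allowedBy-lowest w 0 b z≤n) (cong (_≤ᵇ b) (lowestFrom-start (0 , 0) w))
  row : ∀ a → 0 ≤ a → a ≤ x + 0 → allowedBy w (a , y + 0) ≡ true
  row a _ a≤x+0 rewrite +-identityʳ x | +-identityʳ y =
    trans (allowedBy-lowest w a y (subst (λ q → a ≤ proj₁ q) (sym w-end) a≤x+0))
          (≤⇒≤ᵇ-true (subst (λ q → lowest w a ≤ proj₂ q) w-end (lowestFrom-≤-end (0 , 0) w a)))

-- Counting paths weakly above B by their last step

weaklyAbove-∷ʳ : ∀ w s B → weaklyAbove (w ∷ʳ s) B ≡ weaklyAbove w B ∧ allowedBy B (move (endpoint w) s)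
weaklyAbove-∷ʳ w s B rewrite pointsFrom-∷ʳ (0 , 0) w s = all-∷ʳ (allowedBy B) (points w) _

newContact : Path → Point → Step → ℕ
newContact Q q s = indicator (isE s ∧ elemₑ (q , s) (edges Q))

contacts-∷ʳ : ∀ w s Q → contacts (w ∷ʳ s) Q ≡ contacts w Q + newContact Q (endpoint w) s
contacts-∷ʳ w s Q rewrite edgesFrom-∷ʳ (0 , 0) w s = countᵇ-∷ʳ _ (edges w) (endpoint w , s)

move-==ₚ : ∀ p q s → (move p s ==ₚ move q s) ≡ (p ==ₚ q)
move-==ₚ p q N = refl
move-==ₚ p q E = refl

module PathCounts (T B : Path) where

  allowed : Point → Bool
  allowed = allowedBy B

  topEdge bottomEdge : Point → Bool
  topEdge q    = elemₑ (q , E) (edges T)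
  bottomEdge q = elemₑ (q , E) (edges B)

  -- Predicates on the numbers of contacts with T and with B; the last-step
  -- recursion shifts these numbers (afterStep).
  Contacts : Set
  Contacts = ℕ → ℕ → Bool

  reaches : Point → Contacts → Path → Bool
  reaches q P w = (endpoint w ==ₚ q) ∧ (weaklyAbove w B ∧ P (contacts w T) (contacts w B))

  count : ℕ → ℕ → Contacts → ℕ
  count m n P = countWords (reaches (m , n) P) (m + n)

  afterStep : Point → Step → Contacts → Contacts
  afterStep q s P t b = P (t + newContact T q s) (b + newContact B q s)

  afterEast : Point → Contacts → Contacts
  afterEast q = afterStep q E

  reaches-∷ʳ : ∀ q s P w → reaches (move q s) P (w ∷ʳ s) ≡ allowed (move q s) ∧ reaches q (afterStep q s P) w
  reaches-∷ʳ q s P w = begin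
    reaches (move q s) P (w ∷ʳ s)
      ≡⟨ cong₂ (λ e r → (e ==ₚ move q s) ∧ r) (endpointFrom-∷ʳ (0 , 0) w s)
               (cong₂ (λ a r → a ∧ P r (contacts (w ∷ʳ s) B)) (weaklyAbove-∷ʳ w s B) (contacts-∷ʳ w s T)) ⟩
    (move e s ==ₚ move q s) ∧ ((A ∧ allowed (move e s)) ∧ P (tc + newContact T e s) (contacts (w ∷ʳ s) B))
      ≡⟨ cong₂ (λ u b → u ∧ ((A ∧ allowed (move e s)) ∧ P (tc + newContact T e s) b))
               (move-==ₚ e q s) (contacts-∷ʳ w s B) ⟩
    (e ==ₚ q) ∧ f e
      ≡⟨ ==ₚ-subst e q f ⟩
    (e ==ₚ q) ∧ f q
      ≡⟨ ∧-rearrange (e ==ₚ q) A (allowed (move q s)) _ ⟩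
    allowed (move q s) ∧ reaches q (afterStep q s P) w ∎
    where
    open ≡-Reasoning
    e = endpoint w
    A = weaklyAbove w B
    tc = contacts w T
    f : Point → Bool
    f r = (A ∧ allowed (move r s)) ∧ P (tc + newContact T r s) (contacts w B + newContact B r s)

  reaches-cong : ∀ q {P Q : Contacts} → (∀ t b → P t b ≡ Q t b) → ∀ w → reaches q P w ≡ reaches q Q w
  reaches-cong q P≗Q w = cong (λ u → (endpoint w ==ₚ q) ∧ (weaklyAbove w B ∧ u)) (P≗Q (contacts w T) (contacts w B))

  afterNorth : ∀ q P t b → afterStep q N P t b ≡ P t b
  afterNorth q P t b = cong₂ P (+-identityʳ t) (+-identityʳ b)

  reaches-∷ʳN : ∀ m n P w → reaches (m , suc n) P (w ∷ʳ N) ≡ allowed (m , suc n) ∧ reaches (m , n) P w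
  reaches-∷ʳN m n P w =
    trans (reaches-∷ʳ (m , n) N P w) (cong (allowed (m , suc n) ∧_) (reaches-cong (m , n) (afterNorth (m , n) P) w))

  reaches-∷ʳN-row0 : ∀ m P w → reaches (m , 0) P (w ∷ʳ N) ≡ false
  reaches-∷ʳN-row0 m P w rewrite endpointFrom-∷ʳ (0 , 0) w N = cong (_∧ _) (∧-zeroʳ (proj₁ (endpoint w) ≡ᵇ m))

  reaches-∷ʳE-column0 : ∀ n P w → reaches (0 , n) P (w ∷ʳ E) ≡ false
  reaches-∷ʳE-column0 n P w rewrite endpointFrom-∷ʳ (0 , 0) w E = refl

  count-cong : ∀ m n {P Q : Contacts} → (∀ t b → P t b ≡ Q t b) → count m n P ≡ count m n Q
  count-cong m n P≗Q = countᵇ-cong (reaches-cong (m , n) P≗Q) (allWords (m + n))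

  count-none : ∀ m n → count m n (λ _ _ → false) ≡ 0
  count-none m n = countᵇ-none (λ w → trans (cong ((endpoint w ==ₚ (m , n)) ∧_) (∧-zeroʳ _)) (∧-zeroʳ _)) (allWords (m + n))

  count-origin : ∀ P → count 0 0 P ≡ indicator (allowed (0 , 0) ∧ P 0 0)
  count-origin P = trans (countWords-zero (reaches (0 , 0) P)) (cong (λ a → indicator (a ∧ P 0 0)) (∧-identityʳ _))

  count-column0 : ∀ n P → count 0 (suc n) P ≡ (if allowed (0 , suc n) then count 0 n P else 0)
  count-column0 n P = begin
    count 0 (suc n) P
      ≡⟨ countWords-∷ʳ _ n ⟩
    countWords (λ w → reaches (0 , suc n) P (w ∷ʳ N)) n + countWords (λ w → reaches (0 , suc n) P (w ∷ʳ E)) n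
      ≡⟨ cong₂ _+_ (trans (countᵇ-cong (reaches-∷ʳN 0 n P) (allWords n)) (countWords-if _ _ n))
                   (countᵇ-none (reaches-∷ʳE-column0 (suc n) P) (allWords n)) ⟩
    (if allowed (0 , suc n) then count 0 n P else 0) + 0
      ≡⟨ +-identityʳ _ ⟩
    (if allowed (0 , suc n) then count 0 n P else 0) ∎
    where open ≡-Reasoning

  count-row0 : ∀ m P → count (suc m) 0 P ≡ (if allowed (suc m , 0) then count m 0 (afterEast (m , 0) P) else 0)
  count-row0 m P = begin
    count (suc m) 0 P
      ≡⟨ countWords-∷ʳ _ (m + 0) ⟩
    countWords (λ w → reaches (suc m , 0) P (w ∷ʳ N)) (m + 0) + countWords (λ w → reaches (suc m , 0) P (w ∷ʳ E)) (m + 0)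
      ≡⟨ cong₂ _+_ (countᵇ-none (reaches-∷ʳN-row0 (suc m) P) (allWords (m + 0)))
                   (trans (countᵇ-cong (reaches-∷ʳ (m , 0) E P) (allWords (m + 0))) (countWords-if _ _ (m + 0))) ⟩
    (if allowed (suc m , 0) then count m 0 (afterEast (m , 0) P) else 0) ∎
    where open ≡-Reasoning

  count-interior : ∀ m n P → count (suc m) (suc n) P ≡
    (if allowed (suc m , suc n) then count (suc m) n P + count m (suc n) (afterEast (m , suc n) P) else 0)
  count-interior m n P = begin
    count (suc m) (suc n) P
      ≡⟨ countWords-∷ʳ _ (m + suc n) ⟩
    countWords (λ w → reaches (suc m , suc n) P (w ∷ʳ N)) (m + suc n) +
    countWords (λ w → reaches (suc m , suc n) P (w ∷ʳ E)) (m + suc n)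
      ≡⟨ cong₂ _+_ (trans (countᵇ-cong (reaches-∷ʳN (suc m) n P) (allWords (m + suc n)))
                          (trans (countWords-if _ _ (m + suc n))
                                 (cong (λ k → if ok then countWords (reaches (suc m , n) P) k else 0) (+-suc m n))))
                   (trans (countᵇ-cong (reaches-∷ʳ (m , suc n) E P) (allWords (m + suc n))) (countWords-if _ _ (m + suc n))) ⟩
    (if ok then count (suc m) n P else 0) + (if ok then count m (suc n) (afterEast (m , suc n) P) else 0)
      ≡⟨ if-+ ok _ _ ⟩
    (if ok then count (suc m) n P + count m (suc n) (afterEast (m , suc n) P) else 0) ∎
    where
    open ≡-Reasoning
    ok = allowed (suc m , suc n)

  count-blocked : ∀ m n P → allowed (m , n) ≡ false → count m n P ≡ 0
  count-blocked zero    zero    P blocked = trans (count-origin P) (cong (λ a → indicator (a ∧ P 0 0)) blocked)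
  count-blocked zero    (suc n) P blocked = trans (count-column0 n P) (if-false blocked)
  count-blocked (suc m) zero    P blocked = trans (count-row0 m P) (if-false blocked)
  count-blocked (suc m) (suc n) P blocked = trans (count-interior m n P) (if-false blocked)

  afterEast-edges : ∀ q P {tc bc} → topEdge q ≡ tc → bottomEdge q ≡ bc →
    ∀ t b → afterEast q P t b ≡ P (t + indicator tc) (b + indicator bc)
  afterEast-edges q P refl refl t b = refl

module ContactCounts (x y₀ : ℕ) (B : Path) (B-end : endpoint B ≡ (x , suc (suc y₀))) (B-last : lastStep B N ≡ true) where

  y : ℕ
  y = suc (suc y₀)

  open PathCounts (topPath x y) B

  column-≤-endpoint : ∀ {a} → a ≤ x → a ≤ proj₁ (endpoint B)
  column-≤-endpoint a≤x = subst (λ q → _ ≤ proj₁ q) (sym B-end) a≤x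

  allowed-lowest : ∀ a b → a ≤ x → allowed (a , b) ≡ (lowest B a ≤ᵇ b)
  allowed-lowest a b a≤x = allowedBy-lowest B a b (column-≤-endpoint a≤x)

  bottomEdge-lowest : ∀ a b → a < x → bottomEdge (a , b) ≡ (lowest B (suc a) ≡ᵇ b)
  bottomEdge-lowest a b a<x = eastEdge-lowestFrom (0 , 0) B a b z≤n (column-≤-endpoint a<x)

  topEdge-row : ∀ a b → a < x → topEdge (a , b) ≡ (y ≡ᵇ b)
  topEdge-row a b = eastEdge-topPath x y a b

  lowest-<-top : ∀ a → a ≤ x → lowest B a < y
  lowest-<-top a a≤x = ≤-<-trans (lowest-mono B a≤x)
    (subst (λ q → lowest B (proj₁ q) < proj₂ q) B-end (lowestFrom-lastStep (0 , 0) B B-last))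

  allowed⇒lowest-≤ : ∀ a b → a ≤ x → allowed (a , b) ≡ true → lowest B a ≤ b
  allowed⇒lowest-≤ a b a≤x ok = ≤ᵇ-true⇒≤ (trans (sym (allowed-lowest a b a≤x)) ok)

  lowest-≤⇒allowed : ∀ a b → a ≤ x → lowest B a ≤ b → allowed (a , b) ≡ true
  lowest-≤⇒allowed a b a≤x low≤b = trans (allowed-lowest a b a≤x) (≤⇒≤ᵇ-true low≤b)

  allowed-column0 : ∀ b → allowed (0 , b) ≡ true
  allowed-column0 b = lowest-≤⇒allowed 0 b z≤n (≤-trans (≤-reflexive (lowestFrom-start (0 , 0) B)) z≤n)

  allowed-left : ∀ a b → suc a ≤ x → allowed (suc a , b) ≡ true → allowed (a , b) ≡ true
  allowed-left a b a<x ok = lowest-≤⇒allowed a b (<⇒≤ a<x)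
    (≤-trans (lowestFrom-mono (0 , 0) B a z≤n) (allowed⇒lowest-≤ (suc a) b a<x ok))

  allowed-high : ∀ a b → a ≤ x → suc y₀ ≤ b → allowed (a , b) ≡ true
  allowed-high a b a≤x y₀<b = lowest-≤⇒allowed a b a≤x (≤-trans (≤-pred (lowest-<-top a a≤x)) y₀<b)

  allowed-below : ∀ a b → a < x → allowed (suc a , suc b) ≡ true →
    allowed (suc a , b) ≡ not (bottomEdge (a , suc b))
  allowed-below a b a<x ok = begin
    allowed (suc a , b)              ≡⟨ allowed-lowest (suc a) b a<x ⟩
    lowest B (suc a) ≤ᵇ b             ≡⟨ ≤ᵇ-pred (lowest B (suc a)) b (allowed⇒lowest-≤ (suc a) (suc b) a<x ok) ⟩
    not (lowest B (suc a) ≡ᵇ suc b)   ≡⟨ cong not (sym (bottomEdge-lowest a (suc b) a<x)) ⟩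
    not (bottomEdge (a , suc b)) ∎
    where open ≡-Reasoning

  allowed-row0⇒bottomEdge : ∀ a → a < x → allowed (suc a , 0) ≡ true → bottomEdge (a , 0) ≡ true
  allowed-row0⇒bottomEdge a a<x ok = trans (bottomEdge-lowest a 0 a<x)
    (T⇒≡true (≡⇒≡ᵇ (lowest B (suc a)) 0 (n≤0⇒n≡0 (allowed⇒lowest-≤ (suc a) 0 a<x ok))))

  noBottomEdge-top : ∀ a → a < x → bottomEdge (a , y) ≡ false
  noBottomEdge-top a a<x = trans (bottomEdge-lowest a y a<x) (≢⇒≡ᵇ-false (<⇒≢ (lowest-<-top (suc a) a<x)))

  paths : ℕ → ℕ → ℕ
  paths k n = count k n (λ _ _ → true)

  -- paths to (k , n ∸ 1), where the point (0 , -1) counts as reached by one path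
  pathsBelow : ℕ → ℕ → ℕ
  pathsBelow k       (suc n) = paths k n
  pathsBelow zero    zero    = 1
  pathsBelow (suc k) zero    = 0

  -- pathsBelow (m ∸ j) n when j ≤ m, and 0 otherwise
  contactCount : ℕ → ℕ → ℕ → ℕ
  contactCount zero    m       n = pathsBelow m n
  contactCount (suc j) zero    n = 0
  contactCount (suc j) (suc m) n = contactCount j m n

  paths-column0 : ∀ n → paths 0 n ≡ 1
  paths-column0 zero    = trans (count-origin (λ _ _ → true)) (cong (λ a → indicator (a ∧ true)) (allowed-column0 0))
  paths-column0 (suc n) = trans (count-column0 n (λ _ _ → true)) (trans (if-true (allowed-column0 (suc n))) (paths-column0 n))

  contactCount-column0 : ∀ j n → contactCount j 0 n ≡ contactCount j 0 (suc n)
  contactCount-column0 (suc j) n       = refl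
  contactCount-column0 zero    zero    = sym (paths-column0 0)
  contactCount-column0 zero    (suc n) = trans (paths-column0 n) (sym (paths-column0 (suc n)))

  pathsBelow-step : ∀ k n → suc k ≤ x → allowed (suc k , n) ≡ true →
    pathsBelow (suc k) n + pathsBelow k (suc n) ≡ pathsBelow (suc k) (suc n)
  pathsBelow-step k zero    _ ok = sym (trans (count-row0 k (λ _ _ → true)) (if-true ok))
  pathsBelow-step k (suc n) _ ok = sym (trans (count-interior k n (λ _ _ → true)) (if-true ok))

  contactCount-step : ∀ j m n → suc m ≤ x → allowed (suc m , n) ≡ true →
    contactCount j (suc m) n + contactCount j m (suc n) ≡ contactCount j (suc m) (suc n)
  contactCount-step zero    m       n m<x ok = pathsBelow-step m n m<x ok
  contactCount-step (suc j) zero    n m<x ok = trans (+-identityʳ _) (contactCount-column0 j n)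
  contactCount-step (suc j) (suc m) n m<x ok = contactCount-step j m n (<⇒≤ m<x) (allowed-left (suc m) n m<x ok)

  contactCount-above : ∀ k m n → contactCount k m (suc n) ≡ (if k ≤ᵇ m then paths (m ∸ k) n else 0)
  contactCount-above zero    m       n = refl
  contactCount-above (suc k) zero    n = refl
  contactCount-above (suc k) (suc m) n rewrite ≤ᵇ-suc k m = contactCount-above k m n

  withBottom : (ℕ → Bool) → ℕ → Contacts
  withBottom P₁ j t b = P₁ t ∧ (b ≡ᵇ j)

  module _ (m n : ℕ) (P₁ : ℕ → Bool) (noTop : topEdge (m , n) ≡ false) where

    count-afterNoContact : ∀ j → bottomEdge (m , n) ≡ false →
      count m n (afterEast (m , n) (withBottom P₁ j)) ≡ count m n (withBottom P₁ j)
    count-afterNoContact j noBottom = count-cong m n λ t b →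
      trans (afterEast-edges (m , n) (withBottom P₁ j) noTop noBottom t b)
            (cong₂ (λ u v → P₁ u ∧ (v ≡ᵇ j)) (+-identityʳ t) (+-identityʳ b))

    count-afterBottomContact : ∀ j → bottomEdge (m , n) ≡ true →
      count m n (afterEast (m , n) (withBottom P₁ (suc j))) ≡ count m n (withBottom P₁ j)
    count-afterBottomContact j bottom = count-cong m n λ t b →
      trans (afterEast-edges (m , n) (withBottom P₁ (suc j)) noTop bottom t b)
            (cong₂ _∧_ (cong P₁ (+-identityʳ t)) (+1≡ᵇ-suc b j))

    count-afterBottomContact-zero : bottomEdge (m , n) ≡ true → count m n (afterEast (m , n) (withBottom P₁ 0)) ≡ 0
    count-afterBottomContact-zero bottom = trans (count-cong m n λ t b →
      trans (afterEast-edges (m , n) (withBottom P₁ 0) noTop bottom t b)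
            (trans (cong (P₁ (t + 0) ∧_) (+1≡ᵇ-zero b)) (∧-zeroʳ _)))
      (count-none m n)

  noTopEdge-below : ∀ a b → a < x → b < y → topEdge (a , b) ≡ false
  noTopEdge-below a b a<x b<y = trans (topEdge-row a b a<x) (≢⇒≡ᵇ-false (>⇒≢ b<y))

  count-belowTop : ∀ m n P₁ j → m ≤ x → n < y → allowed (m , n) ≡ true →
    count m n (withBottom P₁ j) ≡ (if P₁ 0 then contactCount j m n else 0)
  count-belowTop zero zero P₁ j _ _ _ =
    trans (count-origin (withBottom P₁ j))
          (trans (cong (λ a → indicator (a ∧ withBottom P₁ j 0 0)) (allowed-column0 0)) (origin (P₁ 0) j))
    where
    origin : ∀ c j → indicator (c ∧ (0 ≡ᵇ j)) ≡ (if c then contactCount j 0 0 else 0)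
    origin true  zero    = refl
    origin true  (suc j) = refl
    origin false j       = refl
  count-belowTop zero (suc n) P₁ j _ n<y _ = begin
    count 0 (suc n) (withBottom P₁ j)
      ≡⟨ trans (count-column0 n (withBottom P₁ j)) (if-true (allowed-column0 (suc n))) ⟩
    count 0 n (withBottom P₁ j)
      ≡⟨ count-belowTop zero n P₁ j z≤n (<-trans (n<1+n n) n<y) (allowed-column0 n) ⟩
    (if P₁ 0 then contactCount j 0 n else 0)
      ≡⟨ cong (λ c → if P₁ 0 then c else 0) (contactCount-column0 j n) ⟩
    (if P₁ 0 then contactCount j 0 (suc n) else 0) ∎
    where open ≡-Reasoning
  count-belowTop (suc m) zero P₁ j m<x n<y ok =
    trans (trans (count-row0 m (withBottom P₁ j)) (if-true ok)) (afterContact j)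
    where
    noTop = noTopEdge-below m 0 m<x n<y
    bottom = allowed-row0⇒bottomEdge m m<x ok
    afterContact : ∀ j → count m 0 (afterEast (m , 0) (withBottom P₁ j)) ≡ (if P₁ 0 then contactCount j (suc m) 0 else 0)
    afterContact zero    = trans (count-afterBottomContact-zero m 0 P₁ noTop bottom) (sym (if-0 (P₁ 0)))
    afterContact (suc j) = trans (count-afterBottomContact m 0 P₁ noTop j bottom)
                                 (count-belowTop m zero P₁ j (<⇒≤ m<x) n<y (allowed-left m 0 m<x ok))
  count-belowTop (suc m) (suc n) P₁ j m<x n<y ok =
    trans (trans (count-interior m n (withBottom P₁ j)) (if-true ok)) (split j (bottomEdge (m , suc n)) refl)
    where
    noTop = noTopEdge-below m (suc n) m<x n<y
    allowed-left′ = allowed-left m (suc n) m<x ok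
    allowed-below′ : ∀ {c} → bottomEdge (m , suc n) ≡ c → allowed (suc m , n) ≡ not c
    allowed-below′ edge = trans (allowed-below m n m<x ok) (cong not edge)
    split : ∀ j c → bottomEdge (m , suc n) ≡ c →
      count (suc m) n (withBottom P₁ j) + count m (suc n) (afterEast (m , suc n) (withBottom P₁ j)) ≡
      (if P₁ 0 then contactCount j (suc m) (suc n) else 0)
    split zero true bottom = begin
      count (suc m) n (withBottom P₁ 0) + count m (suc n) (afterEast (m , suc n) (withBottom P₁ 0))
        ≡⟨ cong₂ _+_ (count-blocked (suc m) n (withBottom P₁ 0) blocked)
                     (count-afterBottomContact-zero m (suc n) P₁ noTop bottom) ⟩
      0
        ≡⟨ sym (trans (cong (λ c → if P₁ 0 then c else 0) (count-blocked (suc m) n _ blocked)) (if-0 (P₁ 0))) ⟩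
      (if P₁ 0 then paths (suc m) n else 0) ∎
      where open ≡-Reasoning
            blocked = allowed-below′ bottom
    split (suc j) true bottom = begin
      count (suc m) n (withBottom P₁ (suc j)) + count m (suc n) (afterEast (m , suc n) (withBottom P₁ (suc j)))
        ≡⟨ cong₂ _+_ (count-blocked (suc m) n (withBottom P₁ (suc j)) blocked)
                     (count-afterBottomContact m (suc n) P₁ noTop j bottom) ⟩
      count m (suc n) (withBottom P₁ j)
        ≡⟨ count-belowTop m (suc n) P₁ j (<⇒≤ m<x) n<y allowed-left′ ⟩
      (if P₁ 0 then contactCount j m (suc n) else 0) ∎
      where open ≡-Reasoning
            blocked = allowed-below′ bottom
    split j false noBottom = begin
      count (suc m) n (withBottom P₁ j) + count m (suc n) (afterEast (m , suc n) (withBottom P₁ j))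
        ≡⟨ cong (count (suc m) n (withBottom P₁ j) +_) (count-afterNoContact m (suc n) P₁ noTop j noBottom) ⟩
      count (suc m) n (withBottom P₁ j) + count m (suc n) (withBottom P₁ j)
        ≡⟨ cong₂ _+_ (count-belowTop (suc m) n P₁ j m<x (<-trans (n<1+n n) n<y) free)
                     (count-belowTop m (suc n) P₁ j (<⇒≤ m<x) n<y allowed-left′) ⟩
      (if P₁ 0 then contactCount j (suc m) n else 0) + (if P₁ 0 then contactCount j m (suc n) else 0)
        ≡⟨ if-+ (P₁ 0) _ _ ⟩
      (if P₁ 0 then contactCount j (suc m) n + contactCount j m (suc n) else 0)
        ≡⟨ cong (λ c → if P₁ 0 then c else 0) (contactCount-step j m n m<x free) ⟩
      (if P₁ 0 then contactCount j (suc m) (suc n) else 0) ∎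
      where open ≡-Reasoning
            free = allowed-below′ noBottom

  module _ (m j : ℕ) (m<x : m < x) where

    private
      top : topEdge (m , y) ≡ true
      top = trans (topEdge-row m y m<x) (≡ᵇ-refl y)

    count-afterTopContact : ∀ i → count m y (afterEast (m , y) (withBottom (_≡ᵇ suc i) j)) ≡ count m y (withBottom (_≡ᵇ i) j)
    count-afterTopContact i = count-cong m y λ t b →
      trans (afterEast-edges (m , y) (withBottom (_≡ᵇ suc i) j) top (noBottomEdge-top m m<x) t b)
            (cong₂ _∧_ (+1≡ᵇ-suc t i) (cong (_≡ᵇ j) (+-identityʳ b)))

    count-afterTopContact-zero : count m y (afterEast (m , y) (withBottom (_≡ᵇ 0) j)) ≡ 0
    count-afterTopContact-zero = trans (count-cong m y λ t b →
      trans (afterEast-edges (m , y) (withBottom (_≡ᵇ 0) j) top (noBottomEdge-top m m<x) t b)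
            (cong (_∧ (b + 0 ≡ᵇ j)) (+1≡ᵇ-zero t)))
      (count-none m y)

  count-topRow : ∀ m i j → m ≤ x → count m y (withBottom (_≡ᵇ i) j) ≡ contactCount (i + j) m (suc y₀)
  count-topRow zero i j _ = begin
    count 0 y (withBottom (_≡ᵇ i) j)
      ≡⟨ trans (count-column0 (suc y₀) (withBottom (_≡ᵇ i) j)) (if-true (allowed-column0 y)) ⟩
    count 0 (suc y₀) (withBottom (_≡ᵇ i) j)
      ≡⟨ count-belowTop 0 (suc y₀) (_≡ᵇ i) j z≤n ≤-refl (allowed-column0 (suc y₀)) ⟩
    (if 0 ≡ᵇ i then contactCount j 0 (suc y₀) else 0)
      ≡⟨ column0 i ⟩
    contactCount (i + j) 0 (suc y₀) ∎
    where
    open ≡-Reasoning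
    column0 : ∀ i → (if 0 ≡ᵇ i then contactCount j 0 (suc y₀) else 0) ≡ contactCount (i + j) 0 (suc y₀)
    column0 zero    = refl
    column0 (suc i) = refl
  count-topRow (suc m) i j m<x = begin
    count (suc m) y (withBottom (_≡ᵇ i) j)
      ≡⟨ trans (count-interior m (suc y₀) (withBottom (_≡ᵇ i) j)) (if-true (allowed-high (suc m) y m<x (n≤1+n _))) ⟩
    count (suc m) (suc y₀) (withBottom (_≡ᵇ i) j) + count m y (afterEast (m , y) (withBottom (_≡ᵇ i) j))
      ≡⟨ cong (_+ count m y (afterEast (m , y) (withBottom (_≡ᵇ i) j)))
              (count-belowTop (suc m) (suc y₀) (_≡ᵇ i) j m<x ≤-refl (allowed-high (suc m) (suc y₀) m<x ≤-refl)) ⟩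
    (if 0 ≡ᵇ i then contactCount j (suc m) (suc y₀) else 0) + count m y (afterEast (m , y) (withBottom (_≡ᵇ i) j))
      ≡⟨ lastEast i ⟩
    contactCount (i + j) (suc m) (suc y₀) ∎
    where
    open ≡-Reasoning
    lastEast : ∀ i → (if 0 ≡ᵇ i then contactCount j (suc m) (suc y₀) else 0)
                     + count m y (afterEast (m , y) (withBottom (_≡ᵇ i) j))
                     ≡ contactCount (i + j) (suc m) (suc y₀)
    lastEast zero    = trans (cong (contactCount j (suc m) (suc y₀) +_) (count-afterTopContact-zero m j m<x)) (+-identityʳ _)
    lastEast (suc i) = trans (count-afterTopContact m j m<x i) (count-topRow m i j (<⇒≤ m<x))

countContacts≡count : ∀ x y B i j →
  countContacts x y (topPath x y) B i j ≡ PathCounts.count (topPath x y) B x y (λ t b → (t ≡ᵇ i) ∧ (b ≡ᵇ j))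
countContacts≡count x y B i j =
  trans (countᵇ-filterᵇ _ _ (filterᵇ (λ w → endpoint w ==ₚ (x , y)) (allWords (x + y))))
        (trans (countᵇ-filterᵇ _ _ (allWords (x + y))) (countᵇ-cong belowTop-redundant (allWords (x + y))))
  where
  belowTop-redundant : ∀ w →
    (endpoint w ==ₚ (x , y)) ∧
      ((weaklyAbove w B ∧ weaklyBelow w (topPath x y)) ∧ ((contacts w (topPath x y) ≡ᵇ i) ∧ (contacts w B ≡ᵇ j)))
    ≡ PathCounts.reaches (topPath x y) B (x , y) (λ t b → (t ≡ᵇ i) ∧ (b ≡ᵇ j)) w
  belowTop-redundant w with endpoint w ==ₚ (x , y) in w-end
  ... | false = refl
  ... | true  = cong (_∧ ((contacts w (topPath x y) ≡ᵇ i) ∧ (contacts w B ≡ᵇ j)))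
                     (trans (cong (weaklyAbove w B ∧_) (weaklyBelow-topPath x y w (==ₚ-true⇒≡ _ _ w-end)))
                            (∧-identityʳ _))

countAbove≡count : ∀ T k n B → countAbove k n B ≡ PathCounts.count T B k n (λ _ _ → true)
countAbove≡count T k n B = trans (countᵇ-filterᵇ _ _ (allWords (k + n)))
  (countᵇ-cong (λ w → cong ((endpoint w ==ₚ (k , n)) ∧_) (sym (∧-identityʳ _))) (allWords (k + n)))

corollary6p2 : (x y : ℕ) (B : Path) →
    2 ≤ y →
    endpoint B ≡ (x , y) →
    weaklyBelow B (topPath x y) ≡ true →
    lastStep B N ≡ true →
    (i j : ℕ) →
    countContacts x y (topPath x y) B i j ≡ countAboveShift x (i + j) (y ∸ 2) B
corollary6p2 x (suc (suc y₀)) B (s≤s (s≤s z≤n)) B-end _ B-last i j = begin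
  countContacts x y (topPath x y) B i j
    ≡⟨ countContacts≡count x y B i j ⟩
  count x y (withBottom (_≡ᵇ i) j)
    ≡⟨ count-topRow x i j ≤-refl ⟩
  contactCount (i + j) x (suc y₀)
    ≡⟨ contactCount-above (i + j) x y₀ ⟩
  (if i + j ≤ᵇ x then paths (x ∸ (i + j)) y₀ else 0)
    ≡⟨ cong (λ c → if i + j ≤ᵇ x then c else 0) (sym (countAbove≡count (topPath x y) (x ∸ (i + j)) y₀ B)) ⟩
  countAboveShift x (i + j) y₀ B ∎
  where
  open ≡-Reasoning
  open ContactCounts x y₀ B B-end B-last
  open PathCounts (topPath x y) B
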